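{- Let $H$ be a Hadamard matrix of order $v$. Let $G(H)$ be the digraph on $2v$ vertices whose adjacency matrix $A(H)$ is the $2v\times 2v$ $0/1$ matrix obtained from $H$ by replacing each entry $1$ by the block $\begin{pmatrix}1&0\\0&1\end{pmatrix}$ and each entry $-1$ by the block $\begin{pmatrix}0&1\\1&0\end{pmatrix}$. Then the strong automorphism group $\mathrm{SAut}(H)$ is isomorphic to the automorphism group of the digraph $G(H)$.
   Context: A Hadamard matrix of order $v$ is a $v\times v$ matrix with entries $\pm1$ satisfying $HH^t=vI_v$. $\mathrm{SAut}(H)$ is the group of $v\times v$ signed permutation matrices $P$ (products of a permutation matrix and a diagonal matrix with diagonal entries in $\{\pm1\}$) such that $PH=HP$. The automorphism group of a digraph is the group of permutations of its vertex set preserving the arc set. -}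

module Defs where

open import Data.Nat as ℕ using (ℕ; zero; suc)
open import Data.Integer as ℤ using (ℤ; +_; -[1+_]; 0ℤ; 1ℤ)
open import Data.Fin using (Fin; zero; suc; _≟_; remQuot)
open import Data.Fin.Permutation using (Permutation′; _⟨$⟩ʳ_)
open import Data.Product using (Σ; _×_; _,_; proj₁)
open import Data.Sum using (_⊎_)
open import Data.Bool using (if_then_else_)
open import Relation.Nullary.Decidable using (⌊_⌋)
open import Relation.Binary.PropositionalEquality using (_≡_)

Matrix : ℕ → Set
Matrix v = Fin v → Fin v → ℤ

sumFin : ∀ {n} → (Fin n → ℤ) → ℤ
sumFin {zero}  f = 0ℤ
sumFin {suc n} f = f zero ℤ.+ sumFin (λ k → f (suc k))

_⊗_ : ∀ {v} → Matrix v → Matrix v → Matrix v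
(M ⊗ N) i j = sumFin (λ k → M i k ℤ.* N k j)

transpose : ∀ {v} → Matrix v → Matrix v
transpose M i j = M j i

scalarI : ∀ {v} → ℤ → Matrix v
scalarI c i j = if ⌊ i ≟ j ⌋ then c else 0ℤ

_≈M_ : ∀ {v} → Matrix v → Matrix v → Set
M ≈M N = ∀ i j → M i j ≡ N i j

IsSign : ℤ → Set
IsSign x = (x ≡ 1ℤ) ⊎ (x ≡ -[1+ 0 ])

IsHadamard : (v : ℕ) → Matrix v → Set
IsHadamard v H = (∀ i j → IsSign (H i j)) × ((H ⊗ transpose H) ≈M scalarI (+ v))

permMatrix : ∀ {v} → Permutation′ v → Matrix v
permMatrix π i j = if ⌊ (π ⟨$⟩ʳ i) ≟ j ⌋ then 1ℤ else 0ℤ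

diagMatrix : ∀ {v} → (Fin v → ℤ) → Matrix v
diagMatrix d i j = if ⌊ i ≟ j ⌋ then d i else 0ℤ

IsSignedPerm : ∀ {v} → Matrix v → Set
IsSignedPerm {v} P =
  Σ (Permutation′ v) λ π → Σ (Fin v → ℤ) λ d →
    (∀ i → IsSign (d i)) × (P ≈M (permMatrix π ⊗ diagMatrix d))

InSAut : ∀ {v} → Matrix v → Matrix v → Set
InSAut H P = IsSignedPerm P × ((P ⊗ H) ≈M (H ⊗ P))

SAut : ∀ {v} → Matrix v → Set
SAut {v} H = Σ (Matrix v) (InSAut H)

-- Vertex x : Fin (v * 2) corresponds to
-- (i , a) = remQuot 2 x, i.e. x = 2 i + a (row/column a of the i-th 2×2 block).
adjA : ∀ {v} → Matrix v → Fin (v ℕ.* 2) → Fin (v ℕ.* 2) → ℕ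
adjA {v} H x y with remQuot {v} 2 x | remQuot {v} 2 y
... | i , a | j , b =
  if ⌊ H i j ℤ.≟ 1ℤ ⌋
    then (if ⌊ a ≟ b ⌋ then 1 else 0)
    else (if ⌊ a ≟ b ⌋ then 0 else 1)

Arc : ∀ {v} → Matrix v → Fin (v ℕ.* 2) → Fin (v ℕ.* 2) → Set
Arc H x y = adjA H x y ≡ 1

IsDigraphAut : ∀ {v} → Matrix v → Permutation′ (v ℕ.* 2) → Set
IsDigraphAut {v} H σ = ∀ x y → (Arc {v} H x y → Arc {v} H (σ ⟨$⟩ʳ x) (σ ⟨$⟩ʳ y))
                         × (Arc {v} H (σ ⟨$⟩ʳ x) (σ ⟨$⟩ʳ y) → Arc {v} H x y)

Aut : ∀ {v} → Matrix v → Set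
Aut {v} H = Σ (Permutation′ (v ℕ.* 2)) (IsDigraphAut {v} H)

_≈S_ : ∀ {v} {H : Matrix v} → SAut H → SAut H → Set
P ≈S Q = proj₁ P ≈M proj₁ Q

_≈A_ : ∀ {v} {H : Matrix v} → Aut H → Aut H → Set
σ ≈A τ = ∀ x → proj₁ σ ⟨$⟩ʳ x ≡ proj₁ τ ⟨$⟩ʳ x

record SAutIsoAut {v} (H : Matrix v) : Set where
  field
    to      : SAut H → Aut H
    from    : Aut H → SAut H
    to-cong   : ∀ {P Q} → _≈S_ {v} {H} P Q → _≈A_ {v} {H} (to P) (to Q)
    from-cong : ∀ {σ τ} → _≈A_ {v} {H} σ τ → _≈S_ {v} {H} (from σ) (from τ)
    to-from : ∀ σ → _≈A_ {v} {H} (to (from σ)) σ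
    from-to : ∀ P → _≈S_ {v} {H} (from (to P)) P
    hom     : ∀ (P Q : SAut H) (r : InSAut H (proj₁ P ⊗ proj₁ Q)) →
              ∀ x → proj₁ (to (proj₁ P ⊗ proj₁ Q , r)) ⟨$⟩ʳ x
                    ≡ proj₁ (to P) ⟨$⟩ʳ (proj₁ (to Q) ⟨$⟩ʳ x)

-- Write the vertices of G(H) as pairs (i , a) of a block i and a bit a; then (i , a) → (j , b) is an
-- arc iff b = a ⊕ [H i j = -1]. A signed permutation matrix with permutation π and signs d acts on
-- vertices by (i , a) ↦ (π⁻¹ i , a ⊕ [d i = -1]), and commuting with H is exactly the condition for
-- this map to preserve arcs; composition of matrices becomes composition of vertex maps.
-- Conversely, the two vertices of a block have no common out-neighbour, whereas two vertices in
-- distinct blocks k ≠ l always have one: otherwise H k j H l j would be the same sign for every j,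
-- contradicting the orthogonality of rows k and l. Hence every automorphism permutes the blocks
-- and is induced by a unique signed permutation commuting with H.

module Submission where

open import Defs
open import Data.Nat as ℕ using (ℕ; zero; suc)
open import Data.Integer as ℤ using (ℤ; +_; 0ℤ; 1ℤ; -1ℤ)
import Data.Integer.Properties as ℤₚ
open import Data.Fin using (Fin; zero; suc; _≟_; remQuot; combine)
open import Data.Fin.Patterns using (0F; 1F)
open import Data.Fin.Properties using (suc-injective; remQuot-combine; combine-remQuot)
open import Data.Fin.Permutation
  using (Permutation′; _⟨$⟩ʳ_; _⟨$⟩ˡ_; inverseˡ; inverseʳ; permutation; flip; _∘ₚ_; _≈_)
open import Data.Product using (_×_; _,_; proj₁; proj₂)
open import Data.Sum using (inj₁; inj₂)
open import Data.Bool using (if_then_else_)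
open import Data.Bool.Properties using (if-float; if-cong-else)
open import Data.Empty using (⊥; ⊥-elim)
open import Function using (_∘_; id; _⇔_; mk⇔; Equivalence)
open import Relation.Nullary using (yes; no)
open import Relation.Nullary.Decidable using (⌊_⌋)
open import Relation.Binary.PropositionalEquality

open Equivalence using (to; from)
open ≡-Reasoning

-- The group of order two

infixl 6 _⊕_

_⊕_ : Fin 2 → Fin 2 → Fin 2
0F ⊕ b  = b
1F ⊕ 0F = 1F
1F ⊕ 1F = 0F

⊕-identityʳ : ∀ a → a ⊕ 0F ≡ a
⊕-identityʳ 0F = refl
⊕-identityʳ 1F = refl

⊕-self : ∀ a → a ⊕ a ≡ 0F
⊕-self 0F = refl
⊕-self 1F = refl

⊕-comm : ∀ a b → a ⊕ b ≡ b ⊕ a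
⊕-comm 0F b  = sym (⊕-identityʳ b)
⊕-comm 1F 0F = refl
⊕-comm 1F 1F = refl

⊕-assoc : ∀ a b c → a ⊕ b ⊕ c ≡ a ⊕ (b ⊕ c)
⊕-assoc 0F b  c  = refl
⊕-assoc 1F 0F c  = refl
⊕-assoc 1F 1F 0F = refl
⊕-assoc 1F 1F 1F = refl

a⊕b⊕b≡a : ∀ a b → a ⊕ b ⊕ b ≡ a
a⊕b⊕b≡a a b = begin
  a ⊕ b ⊕ b    ≡⟨ ⊕-assoc a b b ⟩
  a ⊕ (b ⊕ b)  ≡⟨ cong (a ⊕_) (⊕-self b) ⟩
  a ⊕ 0F       ≡⟨ ⊕-identityʳ a ⟩
  a            ∎

a⊕[a⊕b]≡b : ∀ a b → a ⊕ (a ⊕ b) ≡ b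
a⊕[a⊕b]≡b a b = trans (sym (⊕-assoc a a b)) (cong (_⊕ b) (⊕-self a))

a⊕b⊕[b⊕c]≡a⊕c : ∀ a b c → a ⊕ b ⊕ (b ⊕ c) ≡ a ⊕ c
a⊕b⊕[b⊕c]≡a⊕c a b c = trans (⊕-assoc a b (b ⊕ c)) (cong (a ⊕_) (a⊕[a⊕b]≡b b c))

⊕-cancelʳ : ∀ {a b} c → a ⊕ c ≡ b ⊕ c → a ≡ b
⊕-cancelʳ {a} {b} c eq = begin
  a          ≡⟨ a⊕b⊕b≡a a c ⟨
  a ⊕ c ⊕ c  ≡⟨ cong (_⊕ c) eq ⟩
  b ⊕ c ⊕ c  ≡⟨ a⊕b⊕b≡a b c ⟩
  b          ∎

a≢1F⊕a : ∀ a → a ≢ 1F ⊕ a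
a≢1F⊕a 0F ()
a≢1F⊕a 1F ()

≢⇒≡1F⊕ : ∀ {a b} → a ≢ b → a ≡ 1F ⊕ b
≢⇒≡1F⊕ {0F} {0F} a≢b = ⊥-elim (a≢b refl)
≢⇒≡1F⊕ {0F} {1F} _   = refl
≢⇒≡1F⊕ {1F} {0F} _   = refl
≢⇒≡1F⊕ {1F} {1F} a≢b = ⊥-elim (a≢b refl)

a⊕x≢b⊕y⇒x⊕y≡a⊕[1F⊕b] : ∀ a b x y → a ⊕ x ≢ b ⊕ y → x ⊕ y ≡ a ⊕ (1F ⊕ b)
a⊕x≢b⊕y⇒x⊕y≡a⊕[1F⊕b] a b x y ne = begin
  x ⊕ y                    ≡⟨ cong (_⊕ y) (a⊕[a⊕b]≡b a x) ⟨
  a ⊕ (a ⊕ x) ⊕ y          ≡⟨ cong (λ z → a ⊕ z ⊕ y) (≢⇒≡1F⊕ ne) ⟩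
  a ⊕ (1F ⊕ (b ⊕ y)) ⊕ y   ≡⟨ cong (λ z → a ⊕ z ⊕ y) (⊕-assoc 1F b y) ⟨
  a ⊕ (1F ⊕ b ⊕ y) ⊕ y     ≡⟨ cong (_⊕ y) (⊕-assoc a (1F ⊕ b) y) ⟨
  a ⊕ (1F ⊕ b) ⊕ y ⊕ y     ≡⟨ a⊕b⊕b≡a (a ⊕ (1F ⊕ b)) y ⟩
  a ⊕ (1F ⊕ b)             ∎

sign : Fin 2 → ℤ
sign 0F = 1ℤ
sign 1F = -1ℤ

signBit : ℤ → Fin 2
signBit x = if ⌊ x ℤ.≟ 1ℤ ⌋ then 0F else 1F

sign-isSign : ∀ a → IsSign (sign a)
sign-isSign 0F = inj₁ refl
sign-isSign 1F = inj₂ refl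

sign≢0 : ∀ a → sign a ≢ 0ℤ
sign≢0 0F ()
sign≢0 1F ()

IsSign⇒≢0 : ∀ {x} → IsSign x → x ≢ 0ℤ
IsSign⇒≢0 (inj₁ refl) ()
IsSign⇒≢0 (inj₂ refl) ()

signBit-sign : ∀ a → signBit (sign a) ≡ a
signBit-sign 0F = refl
signBit-sign 1F = refl

sign-signBit : ∀ {x} → IsSign x → sign (signBit x) ≡ x
sign-signBit (inj₁ refl) = refl
sign-signBit (inj₂ refl) = refl

sign-⊕ : ∀ a b → sign (a ⊕ b) ≡ sign a ℤ.* sign b
sign-⊕ 0F b  = sym (ℤₚ.*-identityˡ (sign b))
sign-⊕ 1F 0F = refl
sign-⊕ 1F 1F = refl

signBit-* : ∀ {x y} → IsSign x → IsSign y → signBit (x ℤ.* y) ≡ signBit x ⊕ signBit y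
signBit-* {x} {y} sx sy = begin
  signBit (x ℤ.* y)                                ≡⟨ cong signBit (cong₂ ℤ._*_ (sign-signBit sx) (sign-signBit sy)) ⟨
  signBit (sign (signBit x) ℤ.* sign (signBit y))  ≡⟨ cong signBit (sign-⊕ (signBit x) (signBit y)) ⟨
  signBit (sign (signBit x ⊕ signBit y))           ≡⟨ signBit-sign (signBit x ⊕ signBit y) ⟩
  signBit x ⊕ signBit y                            ∎

-- Sums and monomial matrices

sumFin-cong : ∀ {n} {f g : Fin n → ℤ} → (∀ k → f k ≡ g k) → sumFin f ≡ sumFin g
sumFin-cong {zero}  f≗g = refl
sumFin-cong {suc n} f≗g = cong₂ ℤ._+_ (f≗g zero) (sumFin-cong (f≗g ∘ suc))

sumFin-const : ∀ n c → sumFin {n} (λ _ → c) ≡ + n ℤ.* c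
sumFin-const zero    c = refl
sumFin-const (suc n) c = begin
  c ℤ.+ sumFin {n} (λ _ → c)    ≡⟨ cong (λ z → c ℤ.+ z) (sumFin-const n c) ⟩
  c ℤ.+ + n ℤ.* c               ≡⟨ cong (ℤ._+ + n ℤ.* c) (ℤₚ.*-identityˡ c) ⟨
  1ℤ ℤ.* c ℤ.+ + n ℤ.* c        ≡⟨ ℤₚ.*-distribʳ-+ c 1ℤ (+ n) ⟨
  + suc n ℤ.* c                 ∎

sumFin-single : ∀ {n} (a : Fin n) (f : Fin n → ℤ) → (∀ k → a ≢ k → f k ≡ 0ℤ) → sumFin f ≡ f a
sumFin-single {suc n} zero f vanishes = begin
  f zero ℤ.+ sumFin (f ∘ suc)      ≡⟨ cong (λ z → f zero ℤ.+ z) (sumFin-cong (λ k → vanishes (suc k) λ ())) ⟩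
  f zero ℤ.+ sumFin {n} (λ _ → 0ℤ) ≡⟨ cong (λ z → f zero ℤ.+ z) (trans (sumFin-const n 0ℤ) (ℤₚ.*-zeroʳ (+ n))) ⟩
  f zero ℤ.+ 0ℤ                    ≡⟨ ℤₚ.+-identityʳ (f zero) ⟩
  f zero                           ∎
sumFin-single {suc n} (suc a) f vanishes = begin
  f zero ℤ.+ sumFin (f ∘ suc)      ≡⟨ cong (ℤ._+ sumFin (f ∘ suc)) (vanishes zero λ ()) ⟩
  0ℤ ℤ.+ sumFin (f ∘ suc)          ≡⟨ ℤₚ.+-identityˡ _ ⟩
  sumFin (f ∘ suc)                 ≡⟨ sumFin-single a (f ∘ suc) (λ k a≢k → vanishes (suc k) (a≢k ∘ suc-injective)) ⟩
  f (suc a)                        ∎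

if-≟-yes : ∀ {n} {A : Set} {a b : Fin n} {x y : A} → a ≡ b → (if ⌊ a ≟ b ⌋ then x else y) ≡ x
if-≟-yes {a = a} {b} a≡b with a ≟ b
... | yes _   = refl
... | no a≢b  = ⊥-elim (a≢b a≡b)

if-≟-no : ∀ {n} {A : Set} {a b : Fin n} {x y : A} → a ≢ b → (if ⌊ a ≟ b ⌋ then x else y) ≡ y
if-≟-no {a = a} {b} a≢b with a ≟ b
... | yes a≡b = ⊥-elim (a≢b a≡b)
... | no _    = refl

sumFin-δ : ∀ {n} (a : Fin n) (g : Fin n → ℤ) → sumFin (λ k → if ⌊ a ≟ k ⌋ then g k else 0ℤ) ≡ g a
sumFin-δ a g = trans (sumFin-single a _ (λ k → if-≟-no)) (if-≟-yes {a = a} refl)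

sumFin-constSign≢0 : ∀ {n} → Fin n → ∀ c → sumFin {n} (λ _ → sign c) ≢ 0ℤ
sumFin-constSign≢0 {suc n} _ c sum≡0
  with ℤₚ.i*j≡0⇒i≡0∨j≡0 (+ suc n) (trans (sym (sumFin-const (suc n) (sign c))) sum≡0)
... | inj₁ ()
... | inj₂ c≡0 = sign≢0 c c≡0

flip-cong : ∀ {n} {π ρ : Permutation′ n} → π ≈ ρ → flip π ≈ flip ρ
flip-cong {π = π} {ρ} π≈ρ y = begin
  π ⟨$⟩ˡ y                      ≡⟨ inverseˡ ρ ⟨
  ρ ⟨$⟩ˡ (ρ ⟨$⟩ʳ (π ⟨$⟩ˡ y))    ≡⟨ cong (ρ ⟨$⟩ˡ_) (π≈ρ (π ⟨$⟩ˡ y)) ⟨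
  ρ ⟨$⟩ˡ (π ⟨$⟩ʳ (π ⟨$⟩ˡ y))    ≡⟨ cong (ρ ⟨$⟩ˡ_) (inverseʳ π) ⟩
  ρ ⟨$⟩ˡ y                      ∎

monomial : ∀ {v} → (Fin v → Fin v) → (Fin v → ℤ) → Matrix v
monomial p d i j = if ⌊ p i ≟ j ⌋ then d j else 0ℤ

monomial-cong : ∀ {v} {p p′ : Fin v → Fin v} {d d′ : Fin v → ℤ} →
                (∀ i → p i ≡ p′ i) → (∀ j → d j ≡ d′ j) → monomial p d ≈M monomial p′ d′
monomial-cong p≗p′ d≗d′ i j = cong₂ (λ k c → if ⌊ k ≟ j ⌋ then c else 0ℤ) (p≗p′ i) (d≗d′ j)

monomial-support : ∀ {v} (p : Fin v → Fin v) d {i j x} → x ≢ 0ℤ → x ≡ monomial p d i j → p i ≡ j × x ≡ d j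
monomial-support p d {i} {j} x≢0 x≡ with p i ≟ j
... | yes pi≡j = pi≡j , x≡
... | no _     = ⊥-elim (x≢0 x≡)

monomial-column : ∀ {v} (π : Permutation′ v) d i j →
                  monomial (π ⟨$⟩ʳ_) d i j ≡ (if ⌊ π ⟨$⟩ˡ j ≟ i ⌋ then d j else 0ℤ)
monomial-column π d i j with π ⟨$⟩ʳ i ≟ j | π ⟨$⟩ˡ j ≟ i
... | yes _   | yes _   = refl
... | no _    | no _    = refl
... | yes πi≡j | no πˡj≢i = ⊥-elim (πˡj≢i (trans (cong (π ⟨$⟩ˡ_) (sym πi≡j)) (inverseˡ π)))
... | no πi≢j | yes πˡj≡i = ⊥-elim (πi≢j (trans (cong (π ⟨$⟩ʳ_) (sym πˡj≡i)) (inverseʳ π)))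

⊗-congˡ : ∀ {v} {M M′ N : Matrix v} → M ≈M M′ → (M ⊗ N) ≈M (M′ ⊗ N)
⊗-congˡ {N = N} M≈M′ i j = sumFin-cong (λ k → cong (ℤ._* N k j) (M≈M′ i k))

⊗-congʳ : ∀ {v} {M N N′ : Matrix v} → N ≈M N′ → (M ⊗ N) ≈M (M ⊗ N′)
⊗-congʳ {M = M} N≈N′ i j = sumFin-cong (λ k → cong (M i k ℤ.*_) (N≈N′ k j))

*-if : ∀ x b {y} → x ℤ.* (if b then y else 0ℤ) ≡ (if b then x ℤ.* y else 0ℤ)
*-if x b = trans (if-float (x ℤ.*_) b) (if-cong-else b (ℤₚ.*-zeroʳ x))

monomial-⊗ : ∀ {v} (p : Fin v → Fin v) d N i j → (monomial p d ⊗ N) i j ≡ d (p i) ℤ.* N (p i) j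
monomial-⊗ p d N i j =
  trans (sumFin-cong (λ k → if-float (ℤ._* N k j) ⌊ p i ≟ k ⌋)) (sumFin-δ (p i) (λ k → d k ℤ.* N k j))

⊗-monomial : ∀ {v} (π : Permutation′ v) d N i j → (N ⊗ monomial (π ⟨$⟩ʳ_) d) i j ≡ N i (π ⟨$⟩ˡ j) ℤ.* d j
⊗-monomial π d N i j = trans
  (sumFin-cong (λ k → trans (cong (N i k ℤ.*_) (monomial-column π d k j)) (*-if (N i k) ⌊ π ⟨$⟩ˡ j ≟ k ⌋)))
  (sumFin-δ (π ⟨$⟩ˡ j) (λ k → N i k ℤ.* d j))

monomial-⊗-monomial : ∀ {v} (p : Fin v → Fin v) (ρ : Permutation′ v) d e →
  (monomial p d ⊗ monomial (ρ ⟨$⟩ʳ_) e) ≈M monomial (λ i → ρ ⟨$⟩ʳ p i) (λ k → d (ρ ⟨$⟩ˡ k) ℤ.* e k)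
monomial-⊗-monomial p ρ d e i k = trans (monomial-⊗ p d (monomial (ρ ⟨$⟩ʳ_) e) i k) weights
  where
  weights : d (p i) ℤ.* monomial (ρ ⟨$⟩ʳ_) e (p i) k ≡ monomial (λ i → ρ ⟨$⟩ʳ p i) (λ k → d (ρ ⟨$⟩ˡ k) ℤ.* e k) i k
  weights with ρ ⟨$⟩ʳ p i ≟ k
  ... | yes refl = cong (λ j → d j ℤ.* e (ρ ⟨$⟩ʳ p i)) (sym (inverseˡ ρ))
  ... | no _     = ℤₚ.*-zeroʳ (d (p i))

permMatrix⊗diagMatrix : ∀ {v} (π : Permutation′ v) d → (permMatrix π ⊗ diagMatrix d) ≈M monomial (π ⟨$⟩ʳ_) d
permMatrix⊗diagMatrix π d i j = begin
  (permMatrix π ⊗ diagMatrix d) i j     ≡⟨ sumFin-cong (λ k → if-float (ℤ._* diagMatrix d k j) ⌊ π ⟨$⟩ʳ i ≟ k ⌋) ⟩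
  sumFin (λ k → if ⌊ π ⟨$⟩ʳ i ≟ k ⌋ then 1ℤ ℤ.* diagMatrix d k j else 0ℤ)
                                        ≡⟨ sumFin-δ (π ⟨$⟩ʳ i) (λ k → 1ℤ ℤ.* diagMatrix d k j) ⟩
  1ℤ ℤ.* diagMatrix d (π ⟨$⟩ʳ i) j      ≡⟨ ℤₚ.*-identityˡ _ ⟩
  diagMatrix d (π ⟨$⟩ʳ i) j             ≡⟨ diagonal≡ ⟩
  monomial (π ⟨$⟩ʳ_) d i j              ∎
  where
  diagonal≡ : diagMatrix d (π ⟨$⟩ʳ i) j ≡ monomial (π ⟨$⟩ʳ_) d i j
  diagonal≡ with π ⟨$⟩ʳ i ≟ j
  ... | yes refl = refl
  ... | no _     = refl

signedPerm≈monomial : ∀ {v} {P : Matrix v} π d → P ≈M (permMatrix π ⊗ diagMatrix d) → P ≈M monomial (π ⟨$⟩ʳ_) d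
signedPerm≈monomial π d P≈ i j = trans (P≈ i j) (permMatrix⊗diagMatrix π d i j)

commutes-resp-≈M : ∀ {v} {H P M : Matrix v} → P ≈M M → (P ⊗ H) ≈M (H ⊗ P) → (M ⊗ H) ≈M (H ⊗ M)
commutes-resp-≈M {H = H} P≈M commutes i j =
  trans (sym (⊗-congˡ {N = H} P≈M i j)) (trans (commutes i j) (⊗-congʳ {M = H} P≈M i j))

monomial-injective : ∀ {v} (π ρ : Permutation′ v) {d e} → (∀ j → d j ≢ 0ℤ) →
                     monomial (π ⟨$⟩ʳ_) d ≈M monomial (ρ ⟨$⟩ʳ_) e →
                     ∀ j → π ⟨$⟩ˡ j ≡ ρ ⟨$⟩ˡ j × d j ≡ e j
monomial-injective π ρ {d} {e} d≢0 π≈ρ j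
  with monomial-support (ρ ⟨$⟩ʳ_) e (d≢0 j) (trans (sym (if-≟-yes (inverseʳ π))) (π≈ρ (π ⟨$⟩ˡ j) j))
... | ρπˡj≡j , dj≡ej = trans (sym (inverseˡ ρ)) (cong (ρ ⟨$⟩ˡ_) ρπˡj≡j) , dj≡ej

-- The digraph G(H)

-- adjA H x y unfolds to block₂ (H i j) a b, where (i , a) and (j , b) are the coordinates of x and y.
block₂ : ℤ → Fin 2 → Fin 2 → ℕ
block₂ h a b = if ⌊ h ℤ.≟ 1ℤ ⌋ then (if ⌊ a ≟ b ⌋ then 1 else 0) else (if ⌊ a ≟ b ⌋ then 0 else 1)

block₂≡1⇔ : ∀ h a b → (block₂ h a b ≡ 1) ⇔ (b ≡ a ⊕ signBit h)
block₂≡1⇔ h a b with h ℤ.≟ 1ℤ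
block₂≡1⇔ h 0F 0F | yes _ = mk⇔ (λ _ → refl) (λ _ → refl)
block₂≡1⇔ h 0F 1F | yes _ = mk⇔ (λ ()) (λ ())
block₂≡1⇔ h 1F 0F | yes _ = mk⇔ (λ ()) (λ ())
block₂≡1⇔ h 1F 1F | yes _ = mk⇔ (λ _ → refl) (λ _ → refl)
block₂≡1⇔ h 0F 0F | no _  = mk⇔ (λ ()) (λ ())
block₂≡1⇔ h 0F 1F | no _  = mk⇔ (λ _ → refl) (λ _ → refl)
block₂≡1⇔ h 1F 0F | no _  = mk⇔ (λ _ → refl) (λ _ → refl)
block₂≡1⇔ h 1F 1F | no _  = mk⇔ (λ ()) (λ ())

module Blocks (v : ℕ) where

  vertex : Fin v → Fin 2 → Fin (v ℕ.* 2)
  vertex = combine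

  block : Fin (v ℕ.* 2) → Fin v
  block x = proj₁ (remQuot 2 x)

  bit : Fin (v ℕ.* 2) → Fin 2
  bit x = proj₂ (remQuot {v} 2 x)

  block-vertex : ∀ i a → block (vertex i a) ≡ i
  block-vertex i a = cong proj₁ (remQuot-combine i a)

  bit-vertex : ∀ i a → bit (vertex i a) ≡ a
  bit-vertex i a = cong proj₂ (remQuot-combine i a)

  vertex-block-bit : ∀ x → vertex (block x) (bit x) ≡ x
  vertex-block-bit = combine-remQuot {v} 2

  vertex-≡ : ∀ {x y} → block x ≡ block y → bit x ≡ bit y → x ≡ y
  vertex-≡ {x} {y} blocks bits =
    trans (sym (vertex-block-bit x)) (trans (cong₂ vertex blocks bits) (vertex-block-bit y))

  -- The action on vertices of the signed permutation with block map p and sign bits t.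
  twist : (Fin v → Fin v) → (Fin v → Fin 2) → Fin (v ℕ.* 2) → Fin (v ℕ.* 2)
  twist p t x = vertex (p (block x)) (bit x ⊕ t (block x))

  twist-vertex : ∀ p t i a → twist p t (vertex i a) ≡ vertex (p i) (a ⊕ t i)
  twist-vertex p t i a =
    cong₂ vertex (cong p (block-vertex i a)) (cong₂ _⊕_ (bit-vertex i a) (cong t (block-vertex i a)))

  block-twist : ∀ p t x → block (twist p t x) ≡ p (block x)
  block-twist p t x = block-vertex _ _

  twist-cong : ∀ {p p′ t t′} → (∀ i → p i ≡ p′ i) → (∀ i → t i ≡ t′ i) → ∀ x → twist p t x ≡ twist p′ t′ x
  twist-cong p≗p′ t≗t′ x = cong₂ vertex (p≗p′ (block x)) (cong (bit x ⊕_) (t≗t′ (block x)))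

  twist-∘ : ∀ p t q s x → twist p t (twist q s x) ≡ twist (p ∘ q) (λ i → s i ⊕ t (q i)) x
  twist-∘ p t q s x = cong₂ vertex (cong p (block-twist q s x)) (begin
    bit (twist q s x) ⊕ t (block (twist q s x))
      ≡⟨ cong₂ _⊕_ (bit-vertex (q (block x)) _) (cong t (block-twist q s x)) ⟩
    bit x ⊕ s (block x) ⊕ t (q (block x))
      ≡⟨ ⊕-assoc (bit x) (s (block x)) (t (q (block x))) ⟩
    bit x ⊕ (s (block x) ⊕ t (q (block x)))
      ∎)

  twist-identity : ∀ x → twist id (λ _ → 0F) x ≡ x
  twist-identity x = trans (cong (vertex (block x)) (⊕-identityʳ (bit x))) (vertex-block-bit x)

  twist-inverse : ∀ p t q s → (∀ i → p (q i) ≡ i) → (∀ i → s i ⊕ t (q i) ≡ 0F) →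
                  ∀ x → twist p t (twist q s x) ≡ x
  twist-inverse p t q s pq≗id cancels x =
    trans (twist-∘ p t q s x) (trans (twist-cong pq≗id cancels x) (twist-identity x))

  twistPerm : Permutation′ v → (Fin v → Fin 2) → Permutation′ (v ℕ.* 2)
  twistPerm ρ t = permutation (twist (ρ ⟨$⟩ʳ_) t) (twist (ρ ⟨$⟩ˡ_) (t ∘ (ρ ⟨$⟩ˡ_)))
    (twist-inverse (ρ ⟨$⟩ʳ_) t (ρ ⟨$⟩ˡ_) (t ∘ (ρ ⟨$⟩ˡ_))
      (λ _ → inverseʳ ρ) (λ i → ⊕-self (t (ρ ⟨$⟩ˡ i))))
    (twist-inverse (ρ ⟨$⟩ˡ_) (t ∘ (ρ ⟨$⟩ˡ_)) (ρ ⟨$⟩ʳ_) t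
      (λ _ → inverseˡ ρ) (λ i → trans (cong (λ k → t i ⊕ t k) (inverseˡ ρ)) (⊕-self (t i))))

  blocks-inverse : ∀ p t q s → (∀ x → twist p t (twist q s x) ≡ x) → ∀ j → p (q j) ≡ j
  blocks-inverse p t q s inverse j = begin
    p (q j)                                          ≡⟨ cong (p ∘ q) (block-vertex j 0F) ⟨
    p (q (block y))                                  ≡⟨ cong p (block-twist q s y) ⟨
    p (block (twist q s y))                          ≡⟨ block-twist p t (twist q s y) ⟨
    block (twist p t (twist q s y))                  ≡⟨ cong block (inverse y) ⟩
    block y                                          ≡⟨ block-vertex j 0F ⟩
    j                                                ∎
    where
    y : Fin (v ℕ.* 2)
    y = vertex j 0F

module DigraphOf {v : ℕ} (H : Matrix v) where
  open Blocks v

  Arc⇔ : ∀ x y → Arc H x y ⇔ (bit y ≡ bit x ⊕ signBit (H (block x) (block y)))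
  Arc⇔ x y = block₂≡1⇔ (H (block x) (block y)) (bit x) (bit y)

  Arc-vertex⇔ : ∀ i a j b → Arc H (vertex i a) (vertex j b) ⇔ (b ≡ a ⊕ signBit (H i j))
  Arc-vertex⇔ i a j b =
    subst₂ (λ c d → Arc H (vertex i a) (vertex j b) ⇔ (proj₂ d ≡ proj₂ c ⊕ signBit (H (proj₁ c) (proj₁ d))))
           (remQuot-combine i a) (remQuot-combine j b) (Arc⇔ (vertex i a) (vertex j b))

  -- With d = sign ∘ t this reads H (p i) (p j) = d i * H i j * d j: the monomial matrix conjugates H to itself.
  Compatible : (Fin v → Fin v) → (Fin v → Fin 2) → Set
  Compatible p t = ∀ i j → signBit (H (p i) (p j)) ≡ t i ⊕ signBit (H i j) ⊕ t j

  twistPerm-isDigraphAut : ∀ ρ t → Compatible (ρ ⟨$⟩ʳ_) t → IsDigraphAut H (twistPerm ρ t)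
  twistPerm-isDigraphAut ρ t compatible x y =
      (λ arc → from (Arc-vertex⇔ _ _ _ _) (trans (cong (_⊕ t j) (to (Arc⇔ x y) arc)) (sym shifted)))
    , (λ arc → from (Arc⇔ x y) (⊕-cancelʳ (t j) (trans (to (Arc-vertex⇔ _ _ _ _) arc) shifted)))
    where
    i j : Fin v
    i = block x
    j = block y
    h : Fin 2
    h = signBit (H i j)
    shifted : bit x ⊕ t i ⊕ signBit (H (ρ ⟨$⟩ʳ i) (ρ ⟨$⟩ʳ j)) ≡ bit x ⊕ h ⊕ t j
    shifted = begin
      bit x ⊕ t i ⊕ signBit (H (ρ ⟨$⟩ʳ i) (ρ ⟨$⟩ʳ j))
        ≡⟨ cong (bit x ⊕ t i ⊕_) (trans (compatible i j) (⊕-assoc (t i) h (t j))) ⟩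
      bit x ⊕ t i ⊕ (t i ⊕ (h ⊕ t j))
        ≡⟨ a⊕b⊕[b⊕c]≡a⊕c (bit x) (t i) (h ⊕ t j) ⟩
      bit x ⊕ (h ⊕ t j)
        ≡⟨ ⊕-assoc (bit x) h (t j) ⟨
      bit x ⊕ h ⊕ t j
        ∎

  compatible-of-preservesArcs : ∀ {p t} → (∀ x y → Arc H x y → Arc H (twist p t x) (twist p t y)) → Compatible p t
  compatible-of-preservesArcs {p} {t} preserves i j = begin
    signBit (H (p i) (p j))              ≡⟨ a⊕[a⊕b]≡b (t i) _ ⟨
    t i ⊕ (t i ⊕ signBit (H (p i) (p j))) ≡⟨ cong (t i ⊕_) image ⟨
    t i ⊕ (h ⊕ t j)                      ≡⟨ ⊕-assoc (t i) h (t j) ⟨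
    t i ⊕ h ⊕ t j                        ∎
    where
    h : Fin 2
    h = signBit (H i j)
    image : h ⊕ t j ≡ t i ⊕ signBit (H (p i) (p j))
    image = to (Arc-vertex⇔ (p i) (t i) (p j) (h ⊕ t j))
               (subst₂ (Arc H) (twist-vertex p t i 0F) (twist-vertex p t j h)
                 (preserves _ _ (from (Arc-vertex⇔ i 0F j h) refl)))

  flip-isDigraphAut : ∀ {σ} → IsDigraphAut H σ → IsDigraphAut H (flip σ)
  flip-isDigraphAut {σ} aut x y =
      (λ arc → proj₂ (aut (σ ⟨$⟩ˡ x) (σ ⟨$⟩ˡ y)) (subst₂ (Arc H) (sym (inverseʳ σ)) (sym (inverseʳ σ)) arc))
    , (λ arc → subst₂ (Arc H) (inverseʳ σ) (inverseʳ σ) (proj₁ (aut (σ ⟨$⟩ˡ x) (σ ⟨$⟩ˡ y)) arc))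

  NoCommonOutNeighbour : Fin (v ℕ.* 2) → Fin (v ℕ.* 2) → Set
  NoCommonOutNeighbour x x′ = ∀ z → Arc H x z → Arc H x′ z → ⊥

  twins-noCommonOutNeighbour : ∀ i a → NoCommonOutNeighbour (vertex i a) (vertex i (1F ⊕ a))
  twins-noCommonOutNeighbour i a z arc arc′ =
    a≢1F⊕a a (⊕-cancelʳ (signBit (H i (block z))) (trans (sym (bitOf arc)) (bitOf arc′)))
    where
    bitOf : ∀ {c} → Arc H (vertex i c) z → bit z ≡ c ⊕ signBit (H i (block z))
    bitOf {c} arc = to (Arc-vertex⇔ i c (block z) (bit z)) (subst (Arc H (vertex i c)) (sym (vertex-block-bit z)) arc)

  automorphism-noCommonOutNeighbour : ∀ {σ x x′} → IsDigraphAut H σ →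
    NoCommonOutNeighbour x x′ → NoCommonOutNeighbour (σ ⟨$⟩ʳ x) (σ ⟨$⟩ʳ x′)
  automorphism-noCommonOutNeighbour {σ} aut apart z arc arc′ = apart (σ ⟨$⟩ˡ z) (pullBack arc) (pullBack arc′)
    where
    pullBack : ∀ {u} → Arc H (σ ⟨$⟩ʳ u) z → Arc H u (σ ⟨$⟩ˡ z)
    pullBack {u} arc = proj₂ (aut u (σ ⟨$⟩ˡ z)) (subst (Arc H (σ ⟨$⟩ʳ u)) (sym (inverseʳ σ)) arc)

  module _ (entries : ∀ i j → IsSign (H i j)) (π : Permutation′ v) where

    commutes⇒compatible : ∀ d → (∀ j → IsSign (d j)) →
      (monomial (π ⟨$⟩ʳ_) d ⊗ H) ≈M (H ⊗ monomial (π ⟨$⟩ʳ_) d) → Compatible (π ⟨$⟩ˡ_) (signBit ∘ d)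
    commutes⇒compatible d signs commutes i j = begin
      h′                                         ≡⟨ a⊕b⊕b≡a h′ (signBit (d j)) ⟨
      h′ ⊕ signBit (d j) ⊕ signBit (d j)          ≡⟨ cong (_⊕ signBit (d j)) (signBit-* (entries _ _) (signs j)) ⟨
      signBit (H i′ (π ⟨$⟩ˡ j) ℤ.* d j) ⊕ signBit (d j) ≡⟨ cong (λ z → signBit z ⊕ signBit (d j)) conjugated ⟨
      signBit (d i ℤ.* H i j) ⊕ signBit (d j)     ≡⟨ cong (_⊕ signBit (d j)) (signBit-* (signs i) (entries i j)) ⟩
      signBit (d i) ⊕ signBit (H i j) ⊕ signBit (d j) ∎
      where
      M : Matrix v
      M = monomial (π ⟨$⟩ʳ_) d
      i′ : Fin v
      i′ = π ⟨$⟩ˡ i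
      h′ : Fin 2
      h′ = signBit (H i′ (π ⟨$⟩ˡ j))
      conjugated : d i ℤ.* H i j ≡ H i′ (π ⟨$⟩ˡ j) ℤ.* d j
      conjugated = begin
        d i ℤ.* H i j                          ≡⟨ cong (λ k → d k ℤ.* H k j) (inverseʳ π) ⟨
        d (π ⟨$⟩ʳ i′) ℤ.* H (π ⟨$⟩ʳ i′) j      ≡⟨ monomial-⊗ (π ⟨$⟩ʳ_) d H i′ j ⟨
        (M ⊗ H) i′ j                           ≡⟨ commutes i′ j ⟩
        (H ⊗ M) i′ j                           ≡⟨ ⊗-monomial π d H i′ j ⟩
        H i′ (π ⟨$⟩ˡ j) ℤ.* d j                ∎

    compatible⇒commutes : ∀ t → Compatible (π ⟨$⟩ˡ_) t →
      (monomial (π ⟨$⟩ʳ_) (sign ∘ t) ⊗ H) ≈M (H ⊗ monomial (π ⟨$⟩ʳ_) (sign ∘ t))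
    compatible⇒commutes t compatible i j = begin
      (monomial (π ⟨$⟩ʳ_) (sign ∘ t) ⊗ H) i j      ≡⟨ monomial-⊗ (π ⟨$⟩ʳ_) (sign ∘ t) H i j ⟩
      sign (t i′) ℤ.* H i′ j                      ≡⟨ cong (sign (t i′) ℤ.*_) (sign-signBit (entries i′ j)) ⟨
      sign (t i′) ℤ.* sign (signBit (H i′ j))     ≡⟨ sign-⊕ (t i′) _ ⟨
      sign (t i′ ⊕ signBit (H i′ j))              ≡⟨ cong sign (a⊕b⊕b≡a _ (t j)) ⟨
      sign (t i′ ⊕ signBit (H i′ j) ⊕ t j ⊕ t j)  ≡⟨ cong (λ b → sign (b ⊕ t j)) conjugated ⟨
      sign (signBit (H i (π ⟨$⟩ˡ j)) ⊕ t j)       ≡⟨ sign-⊕ _ (t j) ⟩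
      sign (signBit (H i (π ⟨$⟩ˡ j))) ℤ.* sign (t j) ≡⟨ cong (ℤ._* sign (t j)) (sign-signBit (entries i _)) ⟩
      H i (π ⟨$⟩ˡ j) ℤ.* sign (t j)               ≡⟨ ⊗-monomial π (sign ∘ t) H i j ⟨
      (H ⊗ monomial (π ⟨$⟩ʳ_) (sign ∘ t)) i j      ∎
      where
      i′ : Fin v
      i′ = π ⟨$⟩ʳ i
      conjugated : signBit (H i (π ⟨$⟩ˡ j)) ≡ t i′ ⊕ signBit (H i′ j) ⊕ t j
      conjugated = subst (λ k → signBit (H k (π ⟨$⟩ˡ j)) ≡ t i′ ⊕ signBit (H i′ j) ⊕ t j)
                         (inverseˡ π) (compatible i′ j)

  module _ (hadamard : IsHadamard v H) where

    -- Otherwise H k j * H l j would be the same sign for all j, so rows k ≠ l could not be orthogonal.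
    noCommonOutNeighbour⇒sameBlock : ∀ {x x′} → NoCommonOutNeighbour x x′ → block x ≡ block x′
    noCommonOutNeighbour⇒sameBlock {x} {x′} apart with block x ≟ block x′
    ... | yes same = same
    ... | no k≢l  = ⊥-elim (sumFin-constSign≢0 k c (trans (sym (sumFin-cong rowProduct)) orthogonal))
      where
      k l : Fin v
      k = block x
      l = block x′
      h : Fin v → Fin v → Fin 2
      h i j = signBit (H i j)
      c : Fin 2
      c = bit x ⊕ (1F ⊕ bit x′)
      outNeighbour : ∀ {u} j → Arc H u (vertex j (bit u ⊕ h (block u) j))
      outNeighbour {u} j = subst (λ w → Arc H w (vertex j (bit u ⊕ h (block u) j))) (vertex-block-bit u)
                                 (from (Arc-vertex⇔ (block u) (bit u) j _) refl)
      differ : ∀ j → bit x ⊕ h k j ≢ bit x′ ⊕ h l j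
      differ j same = apart _ (outNeighbour j) (subst (λ b → Arc H x′ (vertex j b)) (sym same) (outNeighbour j))
      rowProduct : ∀ j → H k j ℤ.* H l j ≡ sign c
      rowProduct j = begin
        H k j ℤ.* H l j
          ≡⟨ cong₂ ℤ._*_ (sign-signBit (proj₁ hadamard k j)) (sign-signBit (proj₁ hadamard l j)) ⟨
        sign (h k j) ℤ.* sign (h l j)
          ≡⟨ sign-⊕ (h k j) (h l j) ⟨
        sign (h k j ⊕ h l j)
          ≡⟨ cong sign (a⊕x≢b⊕y⇒x⊕y≡a⊕[1F⊕b] (bit x) (bit x′) (h k j) (h l j) (differ j)) ⟩
        sign c
          ∎
      orthogonal : sumFin (λ j → H k j ℤ.* H l j) ≡ 0ℤ
      orthogonal = trans (proj₂ hadamard k l) (if-≟-no k≢l)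

    module Automorphism (σ : Permutation′ (v ℕ.* 2)) (aut : IsDigraphAut H σ) where

      blockMap : Fin v → Fin v
      blockMap i = block (σ ⟨$⟩ʳ vertex i 0F)

      bitShift : Fin v → Fin 2
      bitShift i = bit (σ ⟨$⟩ʳ vertex i 0F)

      automorphism-vertex : ∀ i a → σ ⟨$⟩ʳ vertex i a ≡ vertex (blockMap i) (a ⊕ bitShift i)
      automorphism-vertex i 0F = sym (vertex-block-bit _)
      automorphism-vertex i 1F =
        trans (sym (vertex-block-bit y₁)) (cong₂ vertex (sym sameBlock) (≢⇒≡1F⊕ differentBit))
        where
        y₀ y₁ : Fin (v ℕ.* 2)
        y₀ = σ ⟨$⟩ʳ vertex i 0F
        y₁ = σ ⟨$⟩ʳ vertex i 1F
        sameBlock : block y₀ ≡ block y₁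
        sameBlock = noCommonOutNeighbour⇒sameBlock
                      (automorphism-noCommonOutNeighbour {σ = σ} aut (twins-noCommonOutNeighbour i 0F))
        differentBit : bit y₁ ≢ bit y₀
        differentBit same = 1F≢0F (begin
          1F                        ≡⟨ bit-vertex i 1F ⟨
          bit (vertex i 1F)         ≡⟨ cong bit (inverseˡ σ) ⟨
          bit (σ ⟨$⟩ˡ y₁)           ≡⟨ cong (bit ∘ (σ ⟨$⟩ˡ_)) (vertex-≡ (sym sameBlock) same) ⟩
          bit (σ ⟨$⟩ˡ y₀)           ≡⟨ cong bit (inverseˡ σ) ⟩
          bit (vertex i 0F)         ≡⟨ bit-vertex i 0F ⟩
          0F                        ∎)
          where
          1F≢0F : 1F ≢ 0F
          1F≢0F ()

      automorphism-twist : ∀ x → σ ⟨$⟩ʳ x ≡ twist blockMap bitShift x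
      automorphism-twist x = trans (cong (σ ⟨$⟩ʳ_) (sym (vertex-block-bit x))) (automorphism-vertex (block x) (bit x))

      compatible : Compatible blockMap bitShift
      compatible = compatible-of-preservesArcs {blockMap} {bitShift} (λ x y arc →
        subst₂ (Arc H) (automorphism-twist x) (automorphism-twist y) (proj₁ (aut x y) arc))

    blockPerm : (σ : Permutation′ (v ℕ.* 2)) → IsDigraphAut H σ → Permutation′ v
    blockPerm σ aut = permutation (blockMap σ aut) (blockMap σ⁻¹ aut⁻¹)
      (blockMaps-inverse σ aut σ⁻¹ aut⁻¹ (λ _ → inverseʳ σ))
      (blockMaps-inverse σ⁻¹ aut⁻¹ σ aut (λ _ → inverseˡ σ))
      where
      open Automorphism
      σ⁻¹ : Permutation′ (v ℕ.* 2)
      σ⁻¹ = flip σ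
      aut⁻¹ : IsDigraphAut H σ⁻¹
      aut⁻¹ = flip-isDigraphAut {σ} aut
      blockMaps-inverse : ∀ σ aut τ aut′ → (∀ x → σ ⟨$⟩ʳ (τ ⟨$⟩ʳ x) ≡ x) →
                          ∀ j → blockMap σ aut (blockMap τ aut′ j) ≡ j
      blockMaps-inverse σ aut τ aut′ στ≗id =
        blocks-inverse (blockMap σ aut) (bitShift σ aut) (blockMap τ aut′) (bitShift τ aut′) λ x → begin
          twist (blockMap σ aut) (bitShift σ aut) (twist (blockMap τ aut′) (bitShift τ aut′) x)
            ≡⟨ cong (twist (blockMap σ aut) (bitShift σ aut)) (automorphism-twist τ aut′ x) ⟨
          twist (blockMap σ aut) (bitShift σ aut) (τ ⟨$⟩ʳ x)  ≡⟨ automorphism-twist σ aut (τ ⟨$⟩ʳ x) ⟨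
          σ ⟨$⟩ʳ (τ ⟨$⟩ʳ x)                                   ≡⟨ στ≗id x ⟩
          x                                                   ∎

-- SAut(H) ≅ Aut(G(H))

module Isomorphism {v : ℕ} (H : Matrix v) (hadamard : IsHadamard v H) where
  open Blocks v
  open DigraphOf H

  private
    entries : ∀ i j → IsSign (H i j)
    entries = proj₁ hadamard

  toAut : SAut H → Aut H
  toAut (P , (π , d , signs , P≈) , commutes) =
      twistPerm (flip π) (signBit ∘ d)
    , twistPerm-isDigraphAut (flip π) (signBit ∘ d)
        (commutes⇒compatible entries π d signs (commutes-resp-≈M (signedPerm≈monomial π d P≈) commutes))

  fromAut : Aut H → SAut H
  fromAut (σ , aut) =
      monomial (π ⟨$⟩ʳ_) d
    , (π , d , sign-isSign ∘ bitShift , λ i j → sym (permMatrix⊗diagMatrix π d i j))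
    , compatible⇒commutes entries π bitShift compatible
    where
    open Automorphism hadamard σ aut
    π : Permutation′ v
    π = flip (blockPerm hadamard σ aut)
    d : Fin v → ℤ
    d = sign ∘ bitShift

  toAut-fromAut : ∀ σ → _≈A_ {v} {H} (toAut (fromAut σ)) σ
  toAut-fromAut (σ , aut) x = begin
    twist blockMap (signBit ∘ sign ∘ bitShift) x
      ≡⟨ twist-cong {p = blockMap} {p′ = blockMap} (λ _ → refl) (signBit-sign ∘ bitShift) x ⟩
    twist blockMap bitShift x
      ≡⟨ automorphism-twist x ⟨
    σ ⟨$⟩ʳ x
      ∎
    where open Automorphism hadamard σ aut

  fromAut-toAut : ∀ P → _≈S_ {v} {H} (fromAut (toAut P)) P
  fromAut-toAut (P , (π , d , signs , P≈) , _) i j =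
    trans (monomial-cong blocks weights i j) (sym (signedPerm≈monomial π d P≈ i j))
    where
    t : Fin v → Fin 2
    t = signBit ∘ d
    blocks : ∀ i → block (twist (π ⟨$⟩ʳ_) (t ∘ (π ⟨$⟩ʳ_)) (vertex i 0F)) ≡ π ⟨$⟩ʳ i
    blocks i = trans (block-twist (π ⟨$⟩ʳ_) (t ∘ (π ⟨$⟩ʳ_)) (vertex i 0F)) (cong (π ⟨$⟩ʳ_) (block-vertex i 0F))
    weights : ∀ i → sign (bit (twist (π ⟨$⟩ˡ_) t (vertex i 0F))) ≡ d i
    weights i = trans (cong (sign ∘ bit) (twist-vertex (π ⟨$⟩ˡ_) t i 0F))
                      (trans (cong sign (bit-vertex _ (t i))) (sign-signBit (signs i)))

  toAut-cong : ∀ {P Q} → _≈S_ {v} {H} P Q → _≈A_ {v} {H} (toAut P) (toAut Q)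
  toAut-cong {P , (π , d , ds , P≈) , _} {Q , (ρ , e , es , Q≈) , _} P≈Q =
    twist-cong (proj₁ ∘ unique) (cong signBit ∘ proj₂ ∘ unique)
    where
    unique : ∀ j → π ⟨$⟩ˡ j ≡ ρ ⟨$⟩ˡ j × d j ≡ e j
    unique = monomial-injective π ρ (IsSign⇒≢0 ∘ ds) λ i j →
      trans (sym (signedPerm≈monomial π d P≈ i j)) (trans (P≈Q i j) (signedPerm≈monomial ρ e Q≈ i j))

  fromAut-cong : ∀ {σ τ} → _≈A_ {v} {H} σ τ → _≈S_ {v} {H} (fromAut σ) (fromAut τ)
  fromAut-cong {σ , _} {τ , _} σ≈τ = monomial-cong blocks weights
    where
    blocks : ∀ i → block (σ ⟨$⟩ˡ vertex i 0F) ≡ block (τ ⟨$⟩ˡ vertex i 0F)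
    blocks i = cong block (flip-cong {π = σ} {τ} σ≈τ (vertex i 0F))
    weights : ∀ i → sign (bit (σ ⟨$⟩ʳ vertex i 0F)) ≡ sign (bit (τ ⟨$⟩ʳ vertex i 0F))
    weights i = cong (sign ∘ bit) (σ≈τ (vertex i 0F))

  toAut-hom : ∀ (P Q : SAut H) (r : InSAut H (proj₁ P ⊗ proj₁ Q)) →
              ∀ x → proj₁ (toAut (proj₁ P ⊗ proj₁ Q , r)) ⟨$⟩ʳ x ≡ proj₁ (toAut P) ⟨$⟩ʳ (proj₁ (toAut Q) ⟨$⟩ʳ x)
  toAut-hom (P , (π , d , ds , P≈) , _) (Q , (ρ , e , es , Q≈) , _) ((κ , f , fs , PQ≈) , _) x = begin
    twist (κ ⟨$⟩ˡ_) (signBit ∘ f) x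
      ≡⟨ twist-cong (proj₁ ∘ unique) bits x ⟩
    twist ((π ⟨$⟩ˡ_) ∘ (ρ ⟨$⟩ˡ_)) (λ k → signBit (e k) ⊕ signBit (d (ρ ⟨$⟩ˡ k))) x
      ≡⟨ twist-∘ (π ⟨$⟩ˡ_) (signBit ∘ d) (ρ ⟨$⟩ˡ_) (signBit ∘ e) x ⟨
    twist (π ⟨$⟩ˡ_) (signBit ∘ d) (twist (ρ ⟨$⟩ˡ_) (signBit ∘ e) x) ∎
    where
    product : monomial (κ ⟨$⟩ʳ_) f ≈M monomial ((π ∘ₚ ρ) ⟨$⟩ʳ_) (λ k → d (ρ ⟨$⟩ˡ k) ℤ.* e k)
    product i j = begin
      monomial (κ ⟨$⟩ʳ_) f i j
        ≡⟨ signedPerm≈monomial κ f PQ≈ i j ⟨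
      (P ⊗ Q) i j
        ≡⟨ ⊗-congˡ {N = Q} (signedPerm≈monomial π d P≈) i j ⟩
      (monomial (π ⟨$⟩ʳ_) d ⊗ Q) i j
        ≡⟨ ⊗-congʳ {M = monomial (π ⟨$⟩ʳ_) d} (signedPerm≈monomial ρ e Q≈) i j ⟩
      (monomial (π ⟨$⟩ʳ_) d ⊗ monomial (ρ ⟨$⟩ʳ_) e) i j
        ≡⟨ monomial-⊗-monomial (π ⟨$⟩ʳ_) ρ d e i j ⟩
      monomial ((π ∘ₚ ρ) ⟨$⟩ʳ_) (λ k → d (ρ ⟨$⟩ˡ k) ℤ.* e k) i j
        ∎
    unique : ∀ k → κ ⟨$⟩ˡ k ≡ π ⟨$⟩ˡ (ρ ⟨$⟩ˡ k) × f k ≡ d (ρ ⟨$⟩ˡ k) ℤ.* e k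
    unique = monomial-injective κ (π ∘ₚ ρ) (IsSign⇒≢0 ∘ fs) product
    bits : ∀ k → signBit (f k) ≡ signBit (e k) ⊕ signBit (d (ρ ⟨$⟩ˡ k))
    bits k = begin
      signBit (f k)                               ≡⟨ cong signBit (proj₂ (unique k)) ⟩
      signBit (d (ρ ⟨$⟩ˡ k) ℤ.* e k)              ≡⟨ signBit-* (ds (ρ ⟨$⟩ˡ k)) (es k) ⟩
      signBit (d (ρ ⟨$⟩ˡ k)) ⊕ signBit (e k)      ≡⟨ ⊕-comm (signBit (d (ρ ⟨$⟩ˡ k))) (signBit (e k)) ⟩
      signBit (e k) ⊕ signBit (d (ρ ⟨$⟩ˡ k))      ∎

mainTheorem10 : (v : ℕ) (H : Matrix v) → IsHadamard v H → SAutIsoAut H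
mainTheorem10 v H hadamard = record
  { to        = toAut
  ; from      = fromAut
  ; to-cong   = λ {P} {Q} → toAut-cong {P} {Q}
  ; from-cong = λ {σ} {τ} → fromAut-cong {σ} {τ}
  ; to-from   = toAut-fromAut
  ; from-to   = fromAut-toAut
  ; hom       = toAut-hom
  }
  where open Isomorphism H hadamard
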